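{- Let $\lambda\ge0$ be an integer and $T$ a positive integer. Let $\mathcal{J}$ be a set of unit processing time jobs with integer release times $r_j$ and deadlines $d_j$ satisfying $d_j-r_j\ge\lambda+1$. Let $\mathcal{J}_{\lambda=0}$ be the job set obtained by replacing each $j\in\mathcal{J}$ by a job $j'$ with $r_{j'}=r_j$, $p_{j'}=1$, $d_{j'}=d_j-\lambda$. Let $OPT$ be the minimum number of calibrations needed to feasibly schedule $\mathcal{J}$ with activation time $\lambda$ and calibrated length $T$, and let $OPT_{\lambda=0}$ be the minimum number of calibrations needed to feasibly schedule $\mathcal{J}_{\lambda=0}$ with activation time $0$ and calibrated length $T$. Then $OPT_{\lambda=0}\le(\lambda+1)\,OPT$.
   Context: Scheduling with calibrations: unlimited identical machines; discrete time. With activation time $\lambda$, a calibration started at integer time $t$ occupies $[t,t+\lambda+T)$, consisting of an activation interval $[t,t+\lambda)$ and a calibrated interval $[t+\lambda,t+\lambda+T)$. Machines process jobs only during calibrated intervals, one job at a time. A unit job $j$ scheduled at integer time $\tau$ (occupying a calibrated slot $[\tau,\tau+1)$) is feasibly scheduled iff $r_j\le\tau$ and $\tau+1\le d_j$. A job set is feasibly scheduled on a set of calibrations if every job is feasibly scheduled and no calibration has two jobs at the same time. -}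

module Defs where

open import Data.Nat using (ℕ; suc; _≤_)
open import Data.Integer as ℤ using (ℤ; +_; _+_; _-_)
open import Data.Fin using (Fin)
open import Data.Product using (Σ; _×_)
open import Relation.Binary.PropositionalEquality using (_≡_)

record Job : Set where
  constructor job
  field
    r : ℤ
    d : ℤ
open Job public

JobSet : ℕ → Set
JobSet n = Fin n → Job

-- Calibration k starts at integer time cal k, occupying
-- [cal k, cal k + act + T); its calibrated interval is
-- [cal k + act, cal k + act + T).  Machines are unlimited, so any
-- family of calibrations can be placed on distinct machines.
-- Job j is assigned to calibration κ j at integer time τ j.
Feasible : (act T : ℕ) {n : ℕ} → JobSet n → ℕ → Set
Feasible act T {n} J m =
  Σ (Fin m → ℤ) λ cal →
  Σ (Fin n → Fin m) λ κ →
  Σ (Fin n → ℤ) λ τ →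
    (∀ j → (cal (κ j) + + act ℤ.≤ τ j)
         × (τ j + + 1 ℤ.≤ cal (κ j) + + act + + T)
         × (r (J j) ℤ.≤ τ j)
         × (τ j + + 1 ℤ.≤ d (J j)))
  × (∀ j j' → κ j ≡ κ j' → τ j ≡ τ j' → j ≡ j')

IsOPT : (act T : ℕ) {n : ℕ} → JobSet n → ℕ → Set
IsOPT act T J opt = Feasible act T J opt × (∀ m → Feasible act T J m → opt ≤ m)

shiftJobs : (act : ℕ) {n : ℕ} → JobSet n → JobSet n
shiftJobs act J j = job (r (J j)) (d (J j) - + act)

-- Every calibration of a schedule with activation time λ is replaced by
-- λ + 1 calibrations without activation, started at c + λ - s for s = 0, …, λ.
-- A job run at slot τ of calibration c is moved back to slot τ - s on the copy s,
-- where s = min(λ, τ - r): the slot stays inside the copy's calibrated interval,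
-- never precedes the release time, and either s = λ (so the job meets d - λ) or
-- the job now runs at r, which meets d - λ because d - r ≥ λ + 1.
module Submission where

open import Defs
open import Data.Nat using (ℕ; suc; _≤_; _*_)
open import Data.Integer using (+_; _-_) renaming (_≤_ to _≤ℤ_)
open import Data.Integer as ℤ using (ℤ; _+_; -_; 0ℤ; 1ℤ; ∣_∣; _≤?_)
open import Data.Integer.Properties
  using (+-monoˡ-≤; +-identityʳ; ≤-refl; ≰⇒>; drop‿+<+; 0≤i⇒+∣i∣≡i; i≤j⇒0≤j-i)
open import Data.Integer.Tactic.RingSolver using (solve-∀)
import Data.Nat as ℕ
import Data.Nat.Properties as ℕ
open import Data.Fin using (Fin; toℕ; fromℕ; fromℕ<; combine; remQuot)
open import Data.Fin.Properties using (toℕ-fromℕ; toℕ-fromℕ<; remQuot-combine; combine-injective)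
open import Data.Product using (Σ-syntax; _×_; _,_; proj₁; proj₂)
open import Relation.Binary.PropositionalEquality
open import Relation.Nullary using (Dec; yes; no)

private
  [i+j]-k≡[i-k]+j : ∀ i j k → i + j - k ≡ i - k + j
  [i+j]-k≡[i-k]+j = solve-∀

  i-[i-j]≡j : ∀ i j → i - (i - j) ≡ j
  i-[i-j]≡j = solve-∀

  [i-k]+k≡i : ∀ i k → i - k + k ≡ i
  [i-k]+k≡i = solve-∀

  [l+i]+[k-i]≡k+l : ∀ i k l → l + i + (k - i) ≡ k + l
  [l+i]+[k-i]≡k+l = solve-∀

  [j-k]+[k-i]≡j-i : ∀ i j k → j - k + (k - i) ≡ j - i
  [j-k]+[k-i]≡j-i = solve-∀

sub-monoˡ-≤ : ∀ k {i j} → i ≤ℤ j → i - k ≤ℤ j - k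
sub-monoˡ-≤ k = +-monoˡ-≤ (- k)

sub-cancelʳ-≡ : ∀ k {i j} → i - k ≡ j - k → i ≡ j
sub-cancelʳ-≡ k {i} {j} eq = begin
  i          ≡⟨ sym ([i-k]+k≡i i k) ⟩
  i - k + k  ≡⟨ cong (_+ k) eq ⟩
  j - k + k  ≡⟨ [i-k]+k≡i j k ⟩
  j          ∎
  where open ≡-Reasoning

l+i≤j-k⇒k+l≤j-i : ∀ l i j k → l + i ≤ℤ j - k → k + l ≤ℤ j - i
l+i≤j-k⇒k+l≤j-i l i j k p =
  subst₂ _≤ℤ_ ([l+i]+[k-i]≡k+l i k l) ([j-k]+[k-i]≡j-i i j k) (+-monoˡ-≤ (k - i) p)

slot-retreat : (a : ℕ) {r t d : ℤ} → r ≤ℤ t → t + 1ℤ ≤ℤ d → + suc a ≤ℤ d - r →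
  Σ[ s ∈ Fin (suc a) ] (r ≤ℤ t - + toℕ s) × (t - + toℕ s + 1ℤ ≤ℤ d - + a)
slot-retreat a {r} {t} {d} r≤t t<d wide = retreat (+ a ≤? t - r)
  where
  Fits : ℕ → Set
  Fits s = (r ≤ℤ t - + s) × (t - + s + 1ℤ ≤ℤ d - + a)

  retreat : Dec (+ a ≤ℤ t - r) → Σ[ s ∈ Fin (suc a) ] Fits (toℕ s)
  retreat (yes a≤t-r) = fromℕ a , subst Fits (sym (toℕ-fromℕ a)) (r≤t-a , t-a<d-a)
    where
    r≤t-a : r ≤ℤ t - + a
    r≤t-a = subst (_≤ℤ t - + a) (+-identityʳ r) (l+i≤j-k⇒k+l≤j-i 0ℤ (+ a) t r a≤t-r)
    t-a<d-a : t - + a + 1ℤ ≤ℤ d - + a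
    t-a<d-a = subst (_≤ℤ d - + a) ([i+j]-k≡[i-k]+j t 1ℤ (+ a)) (sub-monoˡ-≤ (+ a) t<d)
  retreat (no a≰t-r) = fromℕ< gap<1+a , subst Fits (sym (toℕ-fromℕ< gap<1+a)) fits
    where
    gap : ℕ
    gap = ∣ t - r ∣
    +gap≡t-r : + gap ≡ t - r
    +gap≡t-r = 0≤i⇒+∣i∣≡i (i≤j⇒0≤j-i r≤t)
    gap<1+a : gap ℕ.< suc a
    gap<1+a = ℕ.m<n⇒m<1+n (drop‿+<+ (subst (ℤ._< + a) (sym +gap≡t-r) (≰⇒> a≰t-r)))
    t-gap≡r : t - + gap ≡ r
    t-gap≡r = trans (cong (λ x → t - x) +gap≡t-r) (i-[i-j]≡j t r)
    -- wide is read as 1ℤ + + a ≤ d - r, since 1ℤ + + a reduces to + suc a.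
    fits : Fits gap
    fits rewrite t-gap≡r = ≤-refl , l+i≤j-k⇒k+l≤j-i 1ℤ (+ a) d r wide

calibrated-slot-translate : ∀ k {c t} T → c ≤ℤ t → t + 1ℤ ≤ℤ c + T →
  (c - k ≤ℤ t - k) × (t - k + 1ℤ ≤ℤ c - k + T)
calibrated-slot-translate k {c} {t} T c≤t t<c+T =
  sub-monoˡ-≤ k c≤t ,
  subst₂ _≤ℤ_ ([i+j]-k≡[i-k]+j t 1ℤ k) ([i+j]-k≡[i-k]+j c T k) (sub-monoˡ-≤ k t<c+T)

feasible-without-activation : (act T : ℕ) {n m : ℕ} (J : JobSet n) →
  (∀ j → + suc act ≤ℤ d (J j) - r (J j)) →
  Feasible act T J m → Feasible 0 T (shiftJobs act J) (suc act * m)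
feasible-without-activation act T {n} {m} J wide (cal , κ , τ , scheduled , exclusive) =
  cal′ , κ′ , τ′ , scheduled′ , exclusive′
  where
  retreat : ∀ j → Σ[ s ∈ Fin (suc act) ]
    (r (J j) ≤ℤ τ j - + toℕ s) × (τ j - + toℕ s + 1ℤ ≤ℤ d (J j) - + act)
  retreat j = let (_ , _ , r≤τ , τ<d) = scheduled j in slot-retreat act r≤τ τ<d (wide j)

  shift : Fin n → Fin (suc act)
  shift j = proj₁ (retreat j)

  start : Fin (suc act) × Fin m → ℤ
  start (s , k) = cal k + + act - + toℕ s

  cal′ : Fin (suc act * m) → ℤ
  cal′ i = start (remQuot m i)

  κ′ : Fin n → Fin (suc act * m)
  κ′ j = combine (shift j) (κ j)

  τ′ : Fin n → ℤ
  τ′ j = τ j - + toℕ (shift j)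

  cal′-κ′ : ∀ j → cal′ (κ′ j) + + 0 ≡ start (shift j , κ j)
  cal′-κ′ j = trans (+-identityʳ _) (cong start (remQuot-combine (shift j) (κ j)))

  scheduled′ : ∀ j → (cal′ (κ′ j) + + 0 ≤ℤ τ′ j) × (τ′ j + + 1 ≤ℤ cal′ (κ′ j) + + 0 + + T)
                   × (r (J j) ≤ℤ τ′ j) × (τ′ j + + 1 ≤ℤ d (J j) - + act)
  scheduled′ j rewrite cal′-κ′ j =
    let (c≤τ , τ<c+T , _) = scheduled j
        (c′≤τ′ , τ′<c′+T) = calibrated-slot-translate (+ toℕ (shift j)) (+ T) c≤τ τ<c+T
    in c′≤τ′ , τ′<c′+T , proj₂ (retreat j)

  exclusive′ : ∀ j j′ → κ′ j ≡ κ′ j′ → τ′ j ≡ τ′ j′ → j ≡ j′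
  exclusive′ j j′ κ′≡ τ′≡ with combine-injective (shift j) (κ j) (shift j′) (κ j′) κ′≡
  ... | shift≡ , κ≡ =
    exclusive j j′ κ≡ (sub-cancelʳ-≡ (+ toℕ (shift j)) (trans τ′≡ (cong (λ s → τ j′ - + toℕ s) (sym shift≡))))

lemma8 : (act T : ℕ) → 1 ≤ T → (n : ℕ) → (J : JobSet n) →
         (∀ j → + suc act ≤ℤ d (J j) - r (J j)) →
         (opt opt0 : ℕ) →
         IsOPT act T J opt →
         IsOPT 0 T (shiftJobs act J) opt0 →
         opt0 ≤ suc act * opt
lemma8 act T _ n J wide opt opt0 (schedule , _) (_ , minimal0) =
  minimal0 (suc act * opt) (feasible-without-activation act T J wide schedule)
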